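{- Let $\Gamma\neq\mathbb{N}$ be a numerical semigroup. Then \[ \max_{g\in\mathbb{N}\setminus\Gamma}W(g)-\min_{g\in\mathbb{N}\setminus\Gamma}W(g)<2\delta(\Gamma). \] Furthermore, if $\Gamma$ is symmetric, then $\max_{g}W(g)-\min_{g}W(g)<c(\Gamma)$.
   Context: A numerical semigroup is an additive submonoid $\Gamma\subseteq\mathbb{N}$ with finite complement; its elements not in $\Gamma$ are gaps. For $\Delta\subseteq\mathbb{N}$ with finite complement, $c(\Delta)$ is one more than the largest element of $\mathbb{N}\setminus\Delta$ and $\delta(\Delta)=|\{x\in\Delta:x<c(\Delta)\}|$. For a gap $g$ of $\Gamma$, let $\Delta_g=\Gamma\cup(g+\Gamma)$ (the $\Gamma$-semimodule minimally generated by $\{0,g\}$) and $W(g)=2\delta(\Delta_g)-c(\Delta_g)$. $\Gamma$ is symmetric if for all $z\in\mathbb{Z}$: $z\in\Gamma\iff c(\Gamma)-1-z\notin\Gamma$. -}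

module Defs where

open import Data.Bool using (Bool; true; false; if_then_else_; _∨_; _∧_; not)
open import Data.Nat using (ℕ; zero; suc; _+_; _∸_; _≤_; _≤ᵇ_)
open import Data.Integer as ℤ using (ℤ; +_; -[1+_])
open import Data.Product using (Σ; _×_)
open import Relation.Binary.PropositionalEquality using (_≡_)
open import Function.Bundles using (_⇔_)
open import Relation.Nullary using (¬_)

Subsetℕ : Set
Subsetℕ = ℕ → Bool

_∈_ : ℕ → Subsetℕ → Set
n ∈ Δ = Δ n ≡ true

_∉_ : ℕ → Subsetℕ → Set
n ∉ Δ = Δ n ≡ false

CofiniteBound : Subsetℕ → ℕ → Set
CofiniteBound Δ N = ∀ n → N ≤ n → n ∈ Δ

record NumericalSemigroup : Set where
  field
    mem      : Subsetℕ
    zero∈    : 0 ∈ mem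
    closed   : ∀ a b → a ∈ mem → b ∈ mem → (a + b) ∈ mem
    bound    : ℕ
    cofinite : CofiniteBound mem bound
open NumericalSemigroup public

-- conductor Δ N = 1 + (largest element of ℕ ∖ Δ below N), or 0 if none.
-- When CofiniteBound Δ N holds this is c(Δ) (independent of N).
conductor : Subsetℕ → ℕ → ℕ
conductor Δ zero    = zero
conductor Δ (suc n) = if Δ n then conductor Δ n else suc n

countBelow : Subsetℕ → ℕ → ℕ
countBelow Δ zero    = zero
countBelow Δ (suc n) = if Δ n then suc (countBelow Δ n) else countBelow Δ n

deltaInv : Subsetℕ → ℕ → ℕ
deltaInv Δ N = countBelow Δ (conductor Δ N)

cΓ : NumericalSemigroup → ℕ
cΓ S = conductor (mem S) (bound S)

δΓ : NumericalSemigroup → ℕ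
δΓ S = deltaInv (mem S) (bound S)

Δ[_,_] : NumericalSemigroup → ℕ → Subsetℕ
Δ[ S , g ] x = mem S x ∨ ((g ≤ᵇ x) ∧ mem S (x ∸ g))

-- Δ_g is cofinite with the same bound as Γ (since Γ ⊆ Δ_g), so these are c(Δ_g), δ(Δ_g).
cΔ : NumericalSemigroup → ℕ → ℕ
cΔ S g = conductor Δ[ S , g ] (bound S)

δΔ : NumericalSemigroup → ℕ → ℕ
δΔ S g = deltaInv Δ[ S , g ] (bound S)

W : NumericalSemigroup → ℕ → ℤ
W S g = (+ 2) ℤ.* (+ δΔ S g) ℤ.- (+ cΔ S g)

_∈ℤ_ : ℤ → NumericalSemigroup → Set
(+ n)    ∈ℤ S = n ∈ mem S
-[1+ n ] ∈ℤ S = false ≡ true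

Symmetric : NumericalSemigroup → Set
Symmetric S = ∀ (z : ℤ) → (z ∈ℤ S) ⇔ (¬ (((+ cΓ S) ℤ.- (+ 1) ℤ.- z) ∈ℤ S))

-- Write a = δ(Δ_g), p = c(Δ_g), b = δ(Δ_h), q = c(Δ_h) with h a gap, and d = δ(Γ).
-- The claim W(g) − W(h) < 2d reads 2a + q < 2d + 2b + p.  Since Δ_g = Γ ∪ (g + Γ),
-- Δ_g has at most #(Γ ∩ [0,n)) + #(Γ ∩ [0,n−g)) elements below n, while Δ_h ⊇ Γ.
-- If p ≤ q, Δ_g is full on [p,q), so a + (q − p) = #(Δ_g ∩ [0,q)), and it suffices
-- that this is < b + d: for q = c(Γ) because h ∈ Δ_h ∖ Γ forces b > d, and for
-- q < c(Γ) because the Frobenius number F lies in Δ_g ∖ Γ, so F − g ∈ Γ bounds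
-- #(Γ ∩ [0,q−g)) strictly by d.  If q < p, then a ≤ 2d and a ≤ 2b + (p − 1 − q).
-- Finally 2d ≤ c(Γ) for every semigroup, since x and F − x are never both in Γ.
module Submission where

open import Defs
open import Data.Bool using (Bool; true; false; if_then_else_; _∨_; _∧_; T)
open import Data.Bool.Properties using (T-≡)
open import Function.Bundles using (Equivalence)
open import Data.Empty using (⊥; ⊥-elim)
open import Data.Product using (Σ; ∃-syntax; _×_; _,_)
open import Data.Sum using (_⊎_; inj₁; inj₂)
open import Relation.Binary.PropositionalEquality
open import Relation.Nullary using (yes; no)

-- ℕ's _<_ and _*_ stay local to this block, so that ℤ's can be opened for the theorem.
module _ where
  open import Data.Nat
  open import Data.Nat.Properties
  open import Data.Nat.Tactic.RingSolver using (solve-∀)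
  open import Algebra.Properties.CommutativeSemigroup +-commutativeSemigroup using (x∙yz≈y∙xz)

  _⊆_ : Subsetℕ → Subsetℕ → Set
  P ⊆ Q = ∀ x → x ∈ P → x ∈ Q

  ∈⇒∉⇒⊥ : ∀ {x} P → x ∈ P → x ∉ P → ⊥
  ∈⇒∉⇒⊥ P x∈P x∉P with () ← trans (sym x∈P) x∉P

  ⊆-∉ : ∀ {P Q x} → P ⊆ Q → x ∉ Q → x ∉ P
  ⊆-∉ {P} {Q} {x} P⊆Q x∉Q with P x in Px
  ... | true  = ⊥-elim (∈⇒∉⇒⊥ Q (P⊆Q x Px) x∉Q)
  ... | false = refl

  countBelow-suc-∉ : ∀ P {n} → n ∉ P → countBelow P (suc n) ≡ countBelow P n
  countBelow-suc-∉ P n∉P rewrite n∉P = refl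

  countBelow-suc-≤ : ∀ P n → countBelow P n ≤ countBelow P (suc n)
  countBelow-suc-≤ P n with P n
  ... | true  = n≤1+n _
  ... | false = ≤-refl

  countBelow-monoʳ-≤ : ∀ P {m n} → m ≤ n → countBelow P m ≤ countBelow P n
  countBelow-monoʳ-≤ P {n = zero} z≤n = ≤-refl
  countBelow-monoʳ-≤ P {n = suc n} m≤1+n with m≤n⇒m<n∨m≡n m≤1+n
  ... | inj₂ refl = ≤-refl
  ... | inj₁ m<1+n = ≤-trans (countBelow-monoʳ-≤ P (s≤s⁻¹ m<1+n)) (countBelow-suc-≤ P n)

  countBelow-∈-< : ∀ P {x n} → x ∈ P → x < n → suc (countBelow P x) ≤ countBelow P n
  countBelow-∈-< P {x} x∈P x<n with P x | countBelow-monoʳ-≤ P x<n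
  ... | true | 1+x≤n = 1+x≤n

  countBelow-mono-⊆ : ∀ {P Q} → P ⊆ Q → ∀ n → countBelow P n ≤ countBelow Q n
  countBelow-mono-⊆ P⊆Q zero = z≤n
  countBelow-mono-⊆ {P} {Q} P⊆Q (suc n) with P n in Pn | Q n in Qn
  ... | true  | true  = s≤s (countBelow-mono-⊆ P⊆Q n)
  ... | true  | false = ⊥-elim (∈⇒∉⇒⊥ Q (P⊆Q n Pn) Qn)
  ... | false | true  = m≤n⇒m≤1+n (countBelow-mono-⊆ P⊆Q n)
  ... | false | false = countBelow-mono-⊆ P⊆Q n

  countBelow-strict-⊆ : ∀ {P Q x} → P ⊆ Q → x ∈ Q → x ∉ P →
                        ∀ n → x < n → suc (countBelow P n) ≤ countBelow Q n
  countBelow-strict-⊆ {P} {Q} {x} P⊆Q x∈Q x∉P (suc n) x<1+n with m≤n⇒m<n∨m≡n (s≤s⁻¹ x<1+n)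
  ... | inj₂ refl rewrite x∈Q | x∉P = s≤s (countBelow-mono-⊆ P⊆Q x)
  ... | inj₁ x<n with P n in Pn | Q n in Qn | countBelow-strict-⊆ P⊆Q x∈Q x∉P n x<n
  ...   | true  | true  | ih = s≤s ih
  ...   | true  | false | _  = ⊥-elim (∈⇒∉⇒⊥ Q (P⊆Q n Pn) Qn)
  ...   | false | true  | ih = m≤n⇒m≤1+n ih
  ...   | false | false | ih = ih

  countBelow-∸-≤ : ∀ P {m n} → m ≤ n → countBelow P n ≤ countBelow P m + (n ∸ m)
  countBelow-∸-≤ P {m} {n} m≤n =
    subst (λ x → countBelow P x ≤ countBelow P m + (n ∸ m)) (m+[n∸m]≡n m≤n) (+-≤ (n ∸ m))
    where
    +-≤ : ∀ k → countBelow P (m + k) ≤ countBelow P m + k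
    +-≤ zero rewrite +-identityʳ m | +-identityʳ (countBelow P m) = ≤-refl
    +-≤ (suc k) rewrite +-suc m k | +-suc (countBelow P m) k with P (m + k)
    ... | true  = s≤s (+-≤ k)
    ... | false = m≤n⇒m≤1+n (+-≤ k)

  countBelow-∸-full : ∀ P {m n} → m ≤ n → (∀ x → m ≤ x → x ∈ P) →
                      countBelow P n ≡ countBelow P m + (n ∸ m)
  countBelow-∸-full P {m} {n} m≤n full =
    subst (λ x → countBelow P x ≡ countBelow P m + (n ∸ m)) (m+[n∸m]≡n m≤n) (+-full (n ∸ m))
    where
    +-full : ∀ k → countBelow P (m + k) ≡ countBelow P m + k
    +-full zero rewrite +-identityʳ m | +-identityʳ (countBelow P m) = refl
    +-full (suc k) rewrite +-suc m k | +-suc (countBelow P m) k | full (m + k) (m≤m+n m k) =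
      cong suc (+-full k)

  countBelow-∨-≤ : ∀ P Q n → countBelow (λ x → P x ∨ Q x) n ≤ countBelow P n + countBelow Q n
  countBelow-∨-≤ P Q zero = z≤n
  countBelow-∨-≤ P Q (suc n) with P n | Q n | countBelow-∨-≤ P Q n
  ... | true  | true  | ih = s≤s (≤-trans ih (+-monoʳ-≤ (countBelow P n) (n≤1+n _)))
  ... | true  | false | ih = s≤s ih
  ... | false | true  | ih = ≤-trans (s≤s ih) (≤-reflexive (sym (+-suc (countBelow P n) (countBelow Q n))))
  ... | false | false | ih = ih

  countBelow-shift : ∀ P g n → countBelow (λ y → (g ≤ᵇ y) ∧ P (y ∸ g)) n ≡ countBelow P (n ∸ g)
  countBelow-shift P g zero = cong (countBelow P) (sym (0∸n≡0 g))
  countBelow-shift P g (suc n) with g ≤ᵇ n in g≤ᵇn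
  ... | true rewrite +-∸-assoc 1 (≤ᵇ⇒≤ g n (Equivalence.from T-≡ g≤ᵇn)) with P (n ∸ g)
  ...   | true  = cong suc (countBelow-shift P g n)
  ...   | false = countBelow-shift P g n
  countBelow-shift P g (suc n) | false =
    trans (countBelow-shift P g n)
          (cong (countBelow P) (trans (m≤n⇒m∸n≡0 (<⇒≤ n<g)) (sym (m≤n⇒m∸n≡0 n<g))))
    where
    n<g : n < g
    n<g = ≰⇒> (λ g≤n → subst T g≤ᵇn (≤⇒≤ᵇ g≤n))

  indicator : Bool → ℕ
  indicator b = if b then 1 else 0

  countBelow-suc : ∀ P n → countBelow P (suc n) ≡ indicator (P n) + countBelow P n
  countBelow-suc P n with P n
  ... | true  = refl
  ... | false = refl

  countBelow-suc-front : ∀ P n → countBelow P (suc n) ≡ indicator (P 0) + countBelow (λ x → P (suc x)) n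
  countBelow-suc-front P zero with P 0
  ... | true  = refl
  ... | false = refl
  countBelow-suc-front P (suc n)
    rewrite countBelow-suc P (suc n) | countBelow-suc-front P n | countBelow-suc (λ x → P (suc x)) n =
    x∙yz≈y∙xz (indicator (P (suc n))) (indicator (P 0)) _

  countBelow-reverse : ∀ P Q n → (∀ x → x < n → P x ≡ Q (n ∸ suc x)) →
                       countBelow P n ≡ countBelow Q n
  countBelow-reverse P Q zero _ = refl
  countBelow-reverse P Q (suc n) P≡Q
    rewrite countBelow-suc P n | countBelow-suc-front Q n | P≡Q n ≤-refl | n∸n≡0 n =
    cong (indicator (Q 0) +_)
         (countBelow-reverse P (λ x → Q (suc x)) n
           (λ x x<n → trans (P≡Q x (m<n⇒m<1+n x<n)) (cong Q (+-∸-assoc 1 x<n))))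

  countBelow-disjoint : ∀ P Q n → (∀ x → x < n → x ∈ P → x ∈ Q → ⊥) →
                        countBelow P n + countBelow Q n ≤ n
  countBelow-disjoint P Q zero _ = z≤n
  countBelow-disjoint P Q (suc n) disj
    with P n in Pn | Q n in Qn | countBelow-disjoint P Q n (λ x x<n → disj x (m<n⇒m<1+n x<n))
  ... | true  | true  | _  = ⊥-elim (disj n ≤-refl Pn Qn)
  ... | true  | false | ih = s≤s ih
  ... | false | true  | ih = subst (_≤ suc n) (sym (+-suc _ _)) (s≤s ih)
  ... | false | false | ih = m≤n⇒m≤1+n ih

  conductor-zero-or-gap : ∀ Δ N → conductor Δ N ≡ 0 ⊎ ∃[ k ] conductor Δ N ≡ suc k × k ∉ Δ
  conductor-zero-or-gap Δ zero = inj₁ refl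
  conductor-zero-or-gap Δ (suc N) with Δ N in ΔN
  ... | true  = conductor-zero-or-gap Δ N
  ... | false = inj₂ (N , refl , ΔN)

  ∈-above-conductor : ∀ {Δ N} → CofiniteBound Δ N → ∀ x → conductor Δ N ≤ x → x ∈ Δ
  ∈-above-conductor {Δ} {N} cofinite x c≤x with x <? N
  ... | yes x<N = below-bound N x<N c≤x
    where
    below-bound : ∀ N → x < N → conductor Δ N ≤ x → x ∈ Δ
    below-bound (suc N) x<1+N c≤x with Δ N in ΔN
    ... | false = ⊥-elim (<⇒≱ x<1+N c≤x)
    ... | true with m≤n⇒m<n∨m≡n (s≤s⁻¹ x<1+N)
    ...   | inj₂ refl = ΔN
    ...   | inj₁ x<N  = below-bound N x<N c≤x
  ... | no x≮N = cofinite x (≮⇒≥ x≮N)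

  ∉⇒<conductor : ∀ {Δ N} → CofiniteBound Δ N → ∀ {x} → x ∉ Δ → x < conductor Δ N
  ∉⇒<conductor {Δ} cofinite {x} x∉Δ =
    ≰⇒> (λ c≤x → ∈⇒∉⇒⊥ Δ (∈-above-conductor cofinite x c≤x) x∉Δ)

  conductor-anti-⊆ : ∀ {Γ Δ N} → Γ ⊆ Δ → CofiniteBound Γ N → conductor Δ N ≤ conductor Γ N
  conductor-anti-⊆ {Γ} {Δ} {N} Γ⊆Δ cofinite with conductor-zero-or-gap Δ N
  ... | inj₁ c≡0 rewrite c≡0 = z≤n
  ... | inj₂ (k , c≡1+k , k∉Δ) rewrite c≡1+k =
    ∉⇒<conductor cofinite (⊆-∉ Γ⊆Δ k∉Δ)

  deltaInv-above-conductor : ∀ {Δ N n} → CofiniteBound Δ N → conductor Δ N ≤ n →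
                             countBelow Δ n ≡ deltaInv Δ N + (n ∸ conductor Δ N)
  deltaInv-above-conductor {Δ} cofinite c≤n = countBelow-∸-full Δ c≤n (∈-above-conductor cofinite)

  deltaInv-below-conductor : ∀ {Δ N k n} → conductor Δ N ≡ suc k → k ∉ Δ → n ≤ k →
                             deltaInv Δ N ≤ countBelow Δ n + (k ∸ n)
  deltaInv-below-conductor {Δ} {N} {k} {n} c≡1+k k∉Δ n≤k = begin
    deltaInv Δ N                ≡⟨ cong (countBelow Δ) c≡1+k ⟩
    countBelow Δ (suc k)        ≡⟨ countBelow-suc-∉ Δ k∉Δ ⟩
    countBelow Δ k              ≤⟨ countBelow-∸-≤ Δ n≤k ⟩
    countBelow Δ n + (k ∸ n)    ∎
    where open ≤-Reasoning

  2a+q<2d+[2b+p]-if-q≥p : ∀ {a b d p q} → p ≤ q → a + (q ∸ p) < b + d → 2 * a + q < 2 * d + (2 * b + p)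
  2a+q<2d+[2b+p]-if-q≥p {a} {b} {d} {p} {q} p≤q a+t<b+d = begin-strict
    2 * a + q             ≡⟨ cong (2 * a +_) (sym (m+[n∸m]≡n p≤q)) ⟩
    2 * a + (p + t)       ≤⟨ +-monoʳ-≤ (2 * a) (+-monoʳ-≤ p (m≤n+m t t)) ⟩
    2 * a + (p + (t + t)) ≡⟨ regroup a p t ⟩
    2 * (a + t) + p       <⟨ +-monoˡ-< p (*-monoʳ-< 2 a+t<b+d) ⟩
    2 * (b + d) + p       ≡⟨ distribute b d p ⟩
    2 * d + (2 * b + p)   ∎
    where
    open ≤-Reasoning
    t = q ∸ p
    regroup : ∀ a p t → 2 * a + (p + (t + t)) ≡ 2 * (a + t) + p
    regroup = solve-∀
    distribute : ∀ b d p → 2 * (b + d) + p ≡ 2 * d + (2 * b + p)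
    distribute = solve-∀

  2a+q<2d+[2b+p]-if-q<p : ∀ {a b d q k} → q ≤ k → a ≤ 2 * b + (k ∸ q) → a ≤ 2 * d →
                          2 * a + q < 2 * d + (2 * b + suc k)
  2a+q<2d+[2b+p]-if-q<p {a} {b} {d} {q} {k} q≤k a≤2b+s a≤2d = begin-strict
    2 * a + q                       ≤⟨ +-monoˡ-≤ q (+-mono-≤ a≤2b+s (+-monoˡ-≤ 0 a≤2d)) ⟩
    2 * b + s + (2 * d + 0) + q     ≡⟨ regroup (2 * b) s (2 * d) q ⟩
    2 * d + (2 * b + (q + s))       ≡⟨ cong (λ k → 2 * d + (2 * b + k)) (m+[n∸m]≡n q≤k) ⟩
    2 * d + (2 * b + k)             <⟨ +-monoʳ-< (2 * d) (+-monoʳ-< (2 * b) (n<1+n k)) ⟩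
    2 * d + (2 * b + suc k)         ∎
    where
    open ≤-Reasoning
    s = k ∸ q
    regroup : ∀ x s y q → x + s + (y + 0) + q ≡ y + (x + (q + s))
    regroup = solve-∀

  module _ (S : NumericalSemigroup) where
    private
      Γ = mem S
      c = cΓ S
      δ = δΓ S

    Γ⊆Δ : ∀ g → Γ ⊆ Δ[ S , g ]
    Γ⊆Δ g x x∈Γ rewrite x∈Γ = refl

    g∈Δ : ∀ g → g ∈ Δ[ S , g ]
    g∈Δ g with Γ g
    ... | true  = refl
    ... | false rewrite Equivalence.to T-≡ (≤⇒≤ᵇ (≤-refl {g})) | n∸n≡0 g = zero∈ S

    ∈Δ-∉Γ⇒∸∈Γ : ∀ g {x} → x ∈ Δ[ S , g ] → x ∉ Γ → (x ∸ g) ∈ Γ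
    ∈Δ-∉Γ⇒∸∈Γ g {x} x∈Δ x∉Γ rewrite x∉Γ with g ≤ᵇ x
    ... | true = x∈Δ

    Δ-cofinite : ∀ g → CofiniteBound Δ[ S , g ] (bound S)
    Δ-cofinite g x B≤x = Γ⊆Δ g x (cofinite S x B≤x)

    cΔ≤cΓ : ∀ g → cΔ S g ≤ c
    cΔ≤cΓ g = conductor-anti-⊆ (Γ⊆Δ g) (cofinite S)

    countBelow-Δ : ∀ g n → countBelow Δ[ S , g ] n ≤ countBelow Γ n + countBelow Γ (n ∸ g)
    countBelow-Δ g n = begin
      countBelow Δ[ S , g ] n                                  ≤⟨ countBelow-∨-≤ Γ _ n ⟩
      countBelow Γ n + countBelow (λ y → (g ≤ᵇ y) ∧ Γ (y ∸ g)) n ≡⟨ cong (countBelow Γ n +_) (countBelow-shift Γ g n) ⟩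
      countBelow Γ n + countBelow Γ (n ∸ g)                    ∎
      where open ≤-Reasoning

    countBelow-Δ≤2δ : ∀ g {n} → n ≤ c → countBelow Δ[ S , g ] n ≤ 2 * δ
    countBelow-Δ≤2δ g {n} n≤c = ≤-trans (countBelow-Δ g n)
      (+-mono-≤ (countBelow-monoʳ-≤ Γ n≤c)
                (≤-trans (countBelow-monoʳ-≤ Γ (≤-trans (m∸n≤m n g) n≤c)) (m≤m+n δ 0)))

    frobenius : 0 < c → ∃[ F ] c ≡ suc F × F ∉ Γ
    frobenius 0<c with conductor-zero-or-gap Γ (bound S)
    ... | inj₁ c≡0 = ⊥-elim (<⇒≢ 0<c (sym c≡0))
    ... | inj₂ F   = F

    countBelow-∸<δ : ∀ g {n} → cΔ S g ≤ n → n < c → countBelow Γ (n ∸ g) < δ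
    countBelow-∸<δ g {n} cΔ≤n n<c with frobenius (≤-<-trans z≤n n<c)
    ... | F , c≡1+F , F∉Γ = begin-strict
      countBelow Γ (n ∸ g) ≤⟨ countBelow-monoʳ-≤ Γ (∸-monoˡ-≤ g n≤F) ⟩
      countBelow Γ (F ∸ g) <⟨ countBelow-∈-< Γ F∸g∈Γ (≤-<-trans (m∸n≤m F g) F<c) ⟩
      countBelow Γ c       ∎
      where
      open ≤-Reasoning
      F<c : F < c
      F<c = ≤-reflexive (sym c≡1+F)
      n≤F : n ≤ F
      n≤F = s≤s⁻¹ (≤-trans n<c (≤-reflexive c≡1+F))
      F∸g∈Γ : (F ∸ g) ∈ Γ
      F∸g∈Γ = ∈Δ-∉Γ⇒∸∈Γ g (∈-above-conductor (Δ-cofinite g) F (≤-trans cΔ≤n n≤F)) F∉Γ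

    2δ≤c : ∀ {h} → h ∉ Γ → 2 * δ ≤ c
    2δ≤c h∉Γ with frobenius (≤-<-trans z≤n (∉⇒<conductor (cofinite S) h∉Γ))
    ... | F , c≡1+F , F∉Γ = subst (λ c → 2 * countBelow Γ c ≤ c) (sym c≡1+F) (begin
      2 * countBelow Γ (suc F)                      ≡⟨ cong (countBelow Γ (suc F) +_) (trans (+-identityʳ _) Γ≡F∸Γ) ⟩
      countBelow Γ (suc F) + countBelow F∸Γ (suc F) ≤⟨ countBelow-disjoint Γ F∸Γ (suc F) disjoint ⟩
      suc F                                         ∎)
      where
      open ≤-Reasoning
      F∸Γ : Subsetℕ
      F∸Γ x = Γ (F ∸ x)
      Γ≡F∸Γ : countBelow Γ (suc F) ≡ countBelow F∸Γ (suc F)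
      Γ≡F∸Γ = countBelow-reverse Γ F∸Γ (suc F) (λ x x<1+F → cong Γ (sym (m∸[m∸n]≡n (s≤s⁻¹ x<1+F))))
      disjoint : ∀ x → x < suc F → x ∈ Γ → x ∈ F∸Γ → ⊥
      disjoint x x<1+F x∈Γ F∸x∈Γ =
        ∈⇒∉⇒⊥ Γ (subst (_∈ Γ) (m+[n∸m]≡n (s≤s⁻¹ x<1+F)) (closed S x (F ∸ x) x∈Γ F∸x∈Γ)) F∉Γ

    W-inequality-if-q<p : ∀ g h → cΔ S h < cΔ S g →
                          2 * δΔ S g + cΔ S h < 2 * δ + (2 * δΔ S h + cΔ S g)
    W-inequality-if-q<p g h q<p with conductor-zero-or-gap Δ[ S , g ] (bound S)
    ... | inj₁ p≡0 = ⊥-elim (n≮0 (subst (cΔ S h <_) p≡0 q<p))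
    ... | inj₂ (k , p≡1+k , k∉Δ) = subst (λ p → 2 * δΔ S g + q < 2 * δ + (2 * δΔ S h + p)) (sym p≡1+k)
      (2a+q<2d+[2b+p]-if-q<p {b = δΔ S h} {d = δ} q≤k a≤2b+[k∸q] (countBelow-Δ≤2δ g (cΔ≤cΓ g)))
      where
      q = cΔ S h
      q≤k : q ≤ k
      q≤k = s≤s⁻¹ (subst (q <_) p≡1+k q<p)
      a≤2b+[k∸q] : δΔ S g ≤ 2 * δΔ S h + (k ∸ q)
      a≤2b+[k∸q] = begin
        δΔ S g                                          ≤⟨ deltaInv-below-conductor {N = bound S} p≡1+k k∉Δ q≤k ⟩
        countBelow Δ[ S , g ] q + (k ∸ q)               ≤⟨ +-monoˡ-≤ (k ∸ q) (countBelow-Δ g q) ⟩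
        countBelow Γ q + countBelow Γ (q ∸ g) + (k ∸ q) ≤⟨ +-monoˡ-≤ (k ∸ q) (+-mono-≤ Γ≤b (≤-trans shifted≤b (m≤m+n _ 0))) ⟩
        2 * δΔ S h + (k ∸ q)                            ∎
        where
        open ≤-Reasoning
        Γ≤b : countBelow Γ q ≤ δΔ S h
        Γ≤b = countBelow-mono-⊆ (Γ⊆Δ h) q
        shifted≤b : countBelow Γ (q ∸ g) ≤ δΔ S h
        shifted≤b = ≤-trans (countBelow-monoʳ-≤ Γ (m∸n≤m q g)) Γ≤b

    W-inequality-if-p≤q : ∀ g h → h ∉ Γ → cΔ S g ≤ cΔ S h →
                          2 * δΔ S g + cΔ S h < 2 * δ + (2 * δΔ S h + cΔ S g)
    W-inequality-if-p≤q g h h∉Γ p≤q = 2a+q<2d+[2b+p]-if-q≥p {b = δΔ S h} {d = δ} p≤q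
      (subst (_< δΔ S h + δ) (deltaInv-above-conductor (Δ-cofinite g) p≤q) count<b+δ)
      where
      q = cΔ S h
      open ≤-Reasoning
      count<b+δ : countBelow Δ[ S , g ] q < δΔ S h + δ
      count<b+δ with m≤n⇒m<n∨m≡n (cΔ≤cΓ h)
      ... | inj₂ q≡c = begin-strict
        countBelow Δ[ S , g ] q ≤⟨ countBelow-Δ≤2δ g (cΔ≤cΓ h) ⟩
        δ + (δ + 0)             ≡⟨ cong (δ +_) (+-identityʳ δ) ⟩
        δ + δ                   <⟨ +-monoˡ-< δ δ<b ⟩
        δΔ S h + δ              ∎
        where
        δ<b : δ < δΔ S h
        δ<b = subst (λ q → δ < countBelow Δ[ S , h ] q) (sym q≡c)
          (countBelow-strict-⊆ (Γ⊆Δ h) (g∈Δ h) h∉Γ c (∉⇒<conductor (cofinite S) h∉Γ))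
      ... | inj₁ q<c = begin-strict
        countBelow Δ[ S , g ] q               ≤⟨ countBelow-Δ g q ⟩
        countBelow Γ q + countBelow Γ (q ∸ g) <⟨ +-mono-≤-< (countBelow-mono-⊆ (Γ⊆Δ h) q) (countBelow-∸<δ g p≤q q<c) ⟩
        δΔ S h + δ                            ∎

    W-inequality : ∀ g h → h ∉ Γ → 2 * δΔ S g + cΔ S h < 2 * δ + (2 * δΔ S h + cΔ S g)
    W-inequality g h h∉Γ with cΔ S h <? cΔ S g
    ... | yes q<p = W-inequality-if-q<p g h q<p
    ... | no  q≮p = W-inequality-if-p≤q g h h∉Γ (≮⇒≥ q≮p)

open import Data.Nat using (ℕ)
open import Data.Integer using (_-_; _<_; +_; _*_)
import Data.Nat as ℕ
import Data.Nat.Properties as ℕ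
import Data.Integer as ℤ
import Data.Integer.Properties as ℤ
open import Data.Integer.Tactic.RingSolver using (solve-∀)

W-difference-< : ∀ a b p q e → 2 ℕ.* a ℕ.+ q ℕ.< e ℕ.+ (2 ℕ.* b ℕ.+ p) →
                 (+ 2 * + a - + p) - (+ 2 * + b - + q) < + e
W-difference-< a b p q e lt = begin-strict
  (+ 2 * + a - + p) - (+ 2 * + b - + q)   ≡⟨ regroup (+ a) (+ b) (+ p) (+ q) ⟩
  (+ 2 * + a ℤ.+ + q) - (+ 2 * + b ℤ.+ + p) ≡⟨ sym (cong₂ _-_ (embed a q) (embed b p)) ⟩
  + (2 ℕ.* a ℕ.+ q) - + m                 <⟨ ℤ.+-monoˡ-< (ℤ.- + m) (ℤ.+<+ lt) ⟩
  + (e ℕ.+ m) - + m                       ≡⟨ cong (_- + m) (ℤ.pos-+ e m) ⟩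
  + e ℤ.+ + m - + m                       ≡⟨ cancel (+ e) (+ m) ⟩
  + e                                     ∎
  where
  open ℤ.≤-Reasoning
  m = 2 ℕ.* b ℕ.+ p
  embed : ∀ x y → + (2 ℕ.* x ℕ.+ y) ≡ + 2 * + x ℤ.+ + y
  embed x y = trans (ℤ.pos-+ (2 ℕ.* x) y) (cong (ℤ._+ + y) (ℤ.pos-* 2 x))
  regroup : ∀ x y z w → (+ 2 * x - z) - (+ 2 * y - w) ≡ (+ 2 * x ℤ.+ w) - (+ 2 * y ℤ.+ z)
  regroup = solve-∀
  cancel : ∀ x y → x ℤ.+ y - y ≡ x
  cancel = solve-∀

proposition4p3 : (S : NumericalSemigroup) → Σ ℕ (λ g → g ∉ mem S) →
    ((g h : ℕ) → g ∉ mem S → h ∉ mem S → W S g - W S h < (+ 2) * (+ δΓ S))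
    × (Symmetric S → (g h : ℕ) → g ∉ mem S → h ∉ mem S → W S g - W S h < + cΓ S)
proposition4p3 S _ = below-2δ , λ _ → below-c
  where
  below-2δ : (g h : ℕ) → g ∉ mem S → h ∉ mem S → W S g - W S h < (+ 2) * (+ δΓ S)
  below-2δ g h _ h∉Γ = subst (W S g - W S h <_) (ℤ.pos-* 2 (δΓ S))
    (W-difference-< (δΔ S g) (δΔ S h) (cΔ S g) (cΔ S h) _ (W-inequality S g h h∉Γ))
  below-c : (g h : ℕ) → g ∉ mem S → h ∉ mem S → W S g - W S h < + cΓ S
  below-c g h _ h∉Γ = W-difference-< (δΔ S g) (δΔ S h) (cΔ S g) (cΔ S h) _
    (ℕ.<-≤-trans (W-inequality S g h h∉Γ) (ℕ.+-monoˡ-≤ _ (2δ≤c S h∉Γ)))
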